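{- Let $n \geq 1$ and let $(a_1, a_2, \ldots, a_n)$ be a palindromic sequence of positive integers (i.e. $a_i = a_{n+1-i}$ for all $i$). Then there exist integers $k_1$, $w$, $z$, depending only on the sequence $(a_1,\ldots,a_n)$ and not on $a_0$, such that for every $a_0 \in \mathbb{Z}$ and every integer $k \geq k_1$ we have $w+zk \geq 1$ and $$\alpha = [a_0; \overline{a_1, a_2, \ldots, a_n, w + zk}]$$ is an algebraic integer of degree $2$; these constants are such that $[0; \overline{a_1, \ldots, a_n, w+zk}]$ (the fractional part of $\alpha$) is an algebraic integer of degree $2$ in $(0,1)$ for every $k \ge k_1$. In particular, for every $a_0 \in \mathbb{Z}$ there exist infinitely many algebraic integers $\alpha$ of degree $2$ of this form.
   Context: For an integer $b_0$ and positive integers $b_1, b_2, \ldots$, $[b_0; b_1, b_2, \ldots]$ denotes the simple continued fraction $b_0 + \cfrac{1}{b_1 + \cfrac{1}{b_2 + \cdots}}$, and $\overline{c_1, \ldots, c_r}$ denotes that the block $c_1, \ldots, c_r$ is repeated periodically forever. -}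

module Defs where

open import Data.Nat as ℕ using (ℕ; zero; suc; NonZero)
open import Data.Nat.DivMod using (_mod_)
open import Data.Integer as ℤ using (ℤ; +_; -[1+_]; +[1+_])
open import Data.Rational as ℚ using (ℚ; 0ℚ; 1ℚ; Positive; ∣_∣; _-_)
open import Data.Fin using (Fin)
open import Data.Product using (Σ; _×_; _,_; proj₁; ∃)
open import Relation.Nullary using (¬_)

-- Simple continued fractions, given by their sequence of partial
-- quotients  b : ℕ → ℤ  (b 0 = b₀, b 1 = b₁, ...).

-- p / q as a rational number (q ≠ 0 in every use below; the value for
-- q = 0 is an irrelevant default).
frac : ℤ → ℤ → ℚ
frac p (+ zero)    = 0ℚ
frac p +[1+ d ]    = p ℚ./ suc d
frac p -[1+ d ]    = (ℤ.- p) ℚ./ suc d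

-- the three-term recurrence x_j = b_j x_{j-1} + x_{j-2},
-- started from x_{-1} = u, x_{-2} = v; returns (x_j , x_{j-1}).
recur : (ℕ → ℤ) → ℤ → ℤ → ℕ → ℤ × ℤ
recur b u v zero    = (b 0 ℤ.* u ℤ.+ v , u)
recur b u v (suc j) with recur b u v j
... | (x , y) = (b (suc j) ℤ.* x ℤ.+ y , x)

num den : (ℕ → ℤ) → ℕ → ℤ
num b j = proj₁ (recur b (+ 1) (+ 0) j)
den b j = proj₁ (recur b (+ 0) (+ 1) j)

convergent : (ℕ → ℤ) → ℕ → ℚ
convergent b j = frac (num b j) (den b j)

periodicCF : ℤ → (m : ℕ) → .{{NonZero m}} → (Fin m → ℤ) → ℕ → ℤ
periodicCF b₀ m c zero    = b₀
periodicCF b₀ m c (suc i) = c (i mod m)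

snoc : {n : ℕ} → (Fin n → ℤ) → ℤ → Fin (suc n) → ℤ
snoc {zero}  a t Fin.zero    = t
snoc {suc n} a t Fin.zero    = a Fin.zero
snoc {suc n} a t (Fin.suc i) = snoc (λ j → a (Fin.suc j)) t i

-- Real numbers are not available; a real number is represented by a
-- sequence of rationals converging to it (here: the convergents of the
-- continued fraction, which converge to its value).

fromℤ : ℤ → ℚ
fromℤ z = z ℚ./ 1

ConvergesTo : (ℕ → ℚ) → ℚ → Set
ConvergesTo s r = (ε : ℚ) → Positive ε →
  ∃ λ N → (j : ℕ) → N ℕ.≤ j → ∣ s j - r ∣ ℚ.< ε

IrrationalLimit : (ℕ → ℚ) → Set
IrrationalLimit s = (r : ℚ) → ¬ ConvergesTo s r

LimitIsRootOfMonicQuadratic : (ℕ → ℚ) → ℤ → ℤ → Set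
LimitIsRootOfMonicQuadratic s b c =
  ConvergesTo (λ j → s j ℚ.* s j ℚ.+ fromℤ b ℚ.* s j ℚ.+ fromℤ c) 0ℚ

-- the limit α of s is an algebraic integer of degree 2:
-- α is a root of a monic integer polynomial of degree 2 (so α is an
-- algebraic integer of degree ≤ 2) and α is irrational (degree ≠ 1).
LimitIsAlgebraicIntegerOfDegree2 : (ℕ → ℚ) → Set
LimitIsAlgebraicIntegerOfDegree2 s =
  (Σ ℤ λ b → Σ ℤ λ c → LimitIsRootOfMonicQuadratic s b c)
  × IrrationalLimit s

LimitInOpenUnitInterval : (ℕ → ℚ) → Set
LimitInOpenUnitInterval s = Σ ℚ λ δ → Positive δ ×
  (∃ λ N → (j : ℕ) → N ℕ.≤ j → (δ ℚ.≤ s j) × (s j ℚ.≤ 1ℚ - δ))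

LimitsDistinct : (ℕ → ℚ) → (ℕ → ℚ) → Set
LimitsDistinct s t = Σ ℚ λ δ → Positive δ ×
  (∃ λ N → (j : ℕ) → N ℕ.≤ j → δ ℚ.≤ ∣ s j - t j ∣)

αseq : {n : ℕ} → ℤ → (Fin n → ℤ) → ℤ → ℕ → ℚ
αseq {n} a₀ a t = convergent (periodicCF a₀ (suc n) (snoc a t))

-- Let A x = [[x, 1], [1, 0]] and M = A a₁ ⋯ A a_n = [[P, Q], [Q, R]], symmetric because
-- the block is a palindrome, with e = det M = ±1.  The denominators X_j and the numerators
-- Y_j of the convergents of [0; \overline{a₁, …, a_n, t}] are the columns of a product of the
-- matrices A, so after one period they are transformed by M ⊗ A t, and if P c′ = t Q + R the
-- binary form Y² + t X Y − c′ X² is multiplied by - e.  Being bounded, it is o(X²) along the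
-- convergents, so the limit is a root of Y² + t Y − c′ (and α = a₀ + β a root of the shifted
-- polynomial).  The choice t = e R Q + P k, c′ = e R² + k Q satisfies P c′ = t Q + R since
-- e² = 1.  The root is irrational: a rational root of a monic integer polynomial is an integer,
-- and P²(t² + 4 c′) = (P t + 2 Q)² + 4 e is not a square.  Positivity of the partial quotients
-- bounds Y/X away from 0 and 1, and the convergents for t ≥ t′ + 2 stay a fixed distance apart.

module Submission where

open import Defs
open import Data.Nat using (ℕ)
open import Data.Integer using (ℤ; +_; _+_; _*_; _≤_)
open import Data.Fin using (Fin; opposite)
open import Data.List using (List)
open import Data.List.Relation.Unary.All using (All)
open import Data.Product using (Σ; _×_)
open import Relation.Binary.PropositionalEquality using (_≡_)

open import Algebra.Properties.CommutativeSemigroup using (x∙yz≈y∙xz)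
open import Data.Empty using (⊥; ⊥-elim)
open import Data.Fin using (toℕ; fromℕ<) renaming (zero to fzero; suc to fsuc)
import Data.Fin.Properties as FP
open import Data.Integer as ℤ using (-[1+_]; +[1+_]; 0ℤ; _-_; -_; _<_; ∣_∣)
import Data.Integer.Properties as ℤP
open import Data.Integer.Tactic.RingSolver using (solve-∀)
open import Data.List using ([]; _∷_)
open import Data.List.Relation.Unary.All as All using ([]; _∷_)
open import Data.Nat as ℕ using (zero; suc; NonZero)
import Data.Nat.Coprimality as Coprime
open import Data.Nat.DivMod using (_mod_; _%_; _/_; m<n⇒m%n≡m; [m+n]%n≡m%n; m≡m%n+[m/n]*n; m%n<n)
open import Data.Nat.Divisibility using (_∣_; divides; ∣-refl)
import Data.Nat.Properties as ℕP
open import Data.Product using (_,_; proj₁; proj₂)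
open import Data.Rational as ℚ using (ℚ; 0ℚ; 1ℚ; toℚᵘ)
import Data.Rational.Properties as ℚP
open import Data.Rational.Unnormalised using (mkℚᵘ; _≃_; *≡*; *≤*; *<*)
import Data.Rational.Unnormalised.Properties as UP
open import Data.Sum using (_⊎_; inj₁; inj₂)
open import Relation.Binary.Definitions using (tri<; tri≈; tri>)
open import Relation.Binary.PropositionalEquality
  using (_≢_; refl; sym; trans; cong; cong₂; subst; subst₂; module ≡-Reasoning)

0≤+ : ∀ n → 0ℤ ≤ + n
0≤+ n = ℤ.+≤+ ℕ.z≤n

1≤⇒0≤ : ∀ {i} → + 1 ≤ i → 0ℤ ≤ i
1≤⇒0≤ = ℤP.≤-trans (0≤+ 1)

+-nonneg : ∀ {i j} → 0ℤ ≤ i → 0ℤ ≤ j → 0ℤ ≤ i + j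
+-nonneg = ℤP.+-mono-≤

*-nonneg : ∀ {i j} → 0ℤ ≤ i → 0ℤ ≤ j → 0ℤ ≤ i * j
*-nonneg {+ m} {+ n} _ _ = subst (0ℤ ≤_) (ℤP.pos-* m n) (0≤+ (m ℕ.* n))

≤-by : ∀ {i j} d → j ≡ i + d → 0ℤ ≤ d → i ≤ j
≤-by {i} {j} d eq 0≤d = subst (i ≤_) (sym eq) (ℤP.i≤i+j i d {{ℤ.nonNegative 0≤d}})

<-by : ∀ {i j} d → j ≡ i + d + + 1 → 0ℤ ≤ d → i < j
<-by {i} d eq 0≤d = ℤP.suc[i]≤j⇒i<j (≤-by d (trans eq (ring i d)) 0≤d)
  where
  ring : ∀ i d → i + d + + 1 ≡ + 1 + i + d
  ring = solve-∀

1≤* : ∀ {i j} → + 1 ≤ i → + 1 ≤ j → + 1 ≤ i * j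
1≤* {i} {j} 1≤i 1≤j = ≤-by ((i - + 1) * (j - + 1) + (i - + 1) + (j - + 1)) (ring i j)
  (+-nonneg (+-nonneg (*-nonneg i-1≥0 j-1≥0) i-1≥0) j-1≥0)
  where
  i-1≥0 = ℤP.i≤j⇒0≤j-i 1≤i
  j-1≥0 = ℤP.i≤j⇒0≤j-i 1≤j
  ring : ∀ i j → i * j ≡ + 1 + ((i - + 1) * (j - + 1) + (i - + 1) + (j - + 1))
  ring = solve-∀

*-monoˡ-≤-nonneg : ∀ {k i j} → 0ℤ ≤ k → i ≤ j → k * i ≤ k * j
*-monoˡ-≤-nonneg {k} 0≤k = ℤP.*-monoˡ-≤-nonNeg k {{ℤ.nonNegative 0≤k}}

*-monoʳ-≤-nonneg : ∀ {k i j} → 0ℤ ≤ k → i ≤ j → i * k ≤ j * k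
*-monoʳ-≤-nonneg {k} 0≤k = ℤP.*-monoʳ-≤-nonNeg k {{ℤ.nonNegative 0≤k}}

Unit : ℤ → Set
Unit e = e ≡ + 1 ⊎ e ≡ - + 1

Unit-neg : ∀ {e} → Unit e → Unit (- e)
Unit-neg (inj₁ refl) = inj₂ refl
Unit-neg (inj₂ refl) = inj₁ refl

Unit-square : ∀ {e} → Unit e → e * e ≡ + 1
Unit-square (inj₁ refl) = refl
Unit-square (inj₂ refl) = refl

∣Unit*i∣≡∣i∣ : ∀ {e} → Unit e → ∀ i → ∣ e * i ∣ ≡ ∣ i ∣
∣Unit*i∣≡∣i∣ (inj₁ refl) i = cong ∣_∣ (ℤP.*-identityˡ i)
∣Unit*i∣≡∣i∣ (inj₂ refl) i = trans (cong ∣_∣ (ℤP.-1*i≡-i i)) (ℤP.∣-i∣≡∣i∣ i)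

∣_∣ᶻ : ℤ → ℤ
∣ i ∣ᶻ = + ∣ i ∣

∣∣ᶻ-nonneg : ∀ i → 0ℤ ≤ ∣ i ∣ᶻ
∣∣ᶻ-nonneg i = 0≤+ ∣ i ∣

∣+∣ᶻ≤ : ∀ i j → ∣ i + j ∣ᶻ ≤ ∣ i ∣ᶻ + ∣ j ∣ᶻ
∣+∣ᶻ≤ i j = subst (∣ i + j ∣ᶻ ≤_) (ℤP.pos-+ ∣ i ∣ ∣ j ∣) (ℤ.+≤+ (ℤP.∣i+j∣≤∣i∣+∣j∣ i j))

∣-∣ᶻ≤ : ∀ i j → ∣ i - j ∣ᶻ ≤ ∣ i ∣ᶻ + ∣ j ∣ᶻ
∣-∣ᶻ≤ i j = subst (∣ i - j ∣ᶻ ≤_) (ℤP.pos-+ ∣ i ∣ ∣ j ∣) (ℤ.+≤+ (ℤP.∣i-j∣≤∣i∣+∣j∣ i j))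

∣*∣ᶻ : ∀ i j → ∣ i * j ∣ᶻ ≡ ∣ i ∣ᶻ * ∣ j ∣ᶻ
∣*∣ᶻ i j = trans (cong +_ (ℤP.abs-* i j)) (ℤP.pos-* ∣ i ∣ ∣ j ∣)

∣*∣ᶻ-nonneg : ∀ i {j} → 0ℤ ≤ j → ∣ i * j ∣ᶻ ≡ ∣ i ∣ᶻ * j
∣*∣ᶻ-nonneg i {j} 0≤j = trans (∣*∣ᶻ i j) (cong (∣ i ∣ᶻ *_) (ℤP.0≤i⇒+∣i∣≡i 0≤j))

i*i≡∣i∣ᶻ*∣i∣ᶻ : ∀ i → i * i ≡ ∣ i ∣ᶻ * ∣ i ∣ᶻ
i*i≡∣i∣ᶻ*∣i∣ᶻ i with ℤP.+∣i∣≡i⊎+∣i∣≡-i i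
... | inj₁ ∣i∣≡i  = cong₂ _*_ (sym ∣i∣≡i) (sym ∣i∣≡i)
... | inj₂ ∣i∣≡-i = trans (neg-square i) (cong₂ _*_ (sym ∣i∣≡-i) (sym ∣i∣≡-i))
  where
  neg-square : ∀ i → i * i ≡ (- i) * (- i)
  neg-square = solve-∀

*-self-mono-≤ : ∀ {i j} → 0ℤ ≤ i → i ≤ j → i * i ≤ j * j
*-self-mono-≤ 0≤i i≤j = ℤP.≤-trans (*-monoˡ-≤-nonneg 0≤i i≤j) (*-monoʳ-≤-nonneg (ℤP.≤-trans 0≤i i≤j) i≤j)

nonneg-multiple-< : ∀ {f N} → 0ℤ ≤ f → 0ℤ ≤ N → f * N < N → f ≡ 0ℤ
nonneg-multiple-< {+ 0}        _ _   _     = refl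
nonneg-multiple-< {+[1+ k ]} {N} _ 0≤N fN<N = ⊥-elim (ℤP.<-irrefl refl (ℤP.≤-<-trans N≤fN fN<N))
  where
  N≤fN : N ≤ +[1+ k ] * N
  N≤fN = ≤-by (+ k * N) (ring (+ k) N) (*-nonneg (0≤+ k) 0≤N)
    where
    ring : ∀ k N → (+ 1 + k) * N ≡ N + k * N
    ring = solve-∀

Unit-bounds : ∀ {e} → Unit e → (0ℤ ≤ e + + 1) × (0ℤ ≤ + 1 - e)
Unit-bounds (inj₁ refl) = 0≤+ 2 , 0≤+ 0
Unit-bounds (inj₂ refl) = 0≤+ 0 , 0≤+ 2

square≢square+4·unit : ∀ {e} x y → Unit e → + 3 ≤ y → x * x ≢ y * y + + 4 * e
square≢square+4·unit {e} x y e-unit 3≤y x²≡ with ℤP.<-cmp ∣ x ∣ᶻ y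
... | tri< ∣x∣<y _ _ = ℤP.<-irrefl x²≡ (begin-strict
  x * x                   ≡⟨ i*i≡∣i∣ᶻ*∣i∣ᶻ x ⟩
  ∣ x ∣ᶻ * ∣ x ∣ᶻ         ≤⟨ *-self-mono-≤ (∣∣ᶻ-nonneg x) ∣x∣≤y-1 ⟩
  (y - + 1) * (y - + 1)   <⟨ <-by gap (ring y e) 0≤gap ⟩
  y * y + + 4 * e         ∎)
  where
  open ℤP.≤-Reasoning
  ∣x∣≤y-1 = ≤-by (y - (+ 1 + ∣ x ∣ᶻ)) (ring″ y ∣ x ∣ᶻ) (ℤP.i≤j⇒0≤j-i (ℤP.i<j⇒suc[i]≤j ∣x∣<y))
    where
    ring″ : ∀ y a → y - + 1 ≡ a + (y - (+ 1 + a))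
    ring″ = solve-∀
  gap = + 2 * (y - + 3) + + 4 * (e + + 1)
  0≤gap = +-nonneg (*-nonneg (0≤+ 2) (ℤP.i≤j⇒0≤j-i 3≤y)) (*-nonneg (0≤+ 4) (proj₁ (Unit-bounds e-unit)))
  ring : ∀ y e → y * y + + 4 * e ≡ (y - + 1) * (y - + 1) + (+ 2 * (y - + 3) + + 4 * (e + + 1)) + + 1
  ring = solve-∀
... | tri≈ _ ∣x∣≡y _ = 4*unit≢0 e-unit (trans (ring (y * y) e) (trans (cong (λ z → z - y * y) (sym y²≡)) (ℤP.+-inverseʳ (y * y))))
  where
  y²≡ : y * y ≡ y * y + + 4 * e
  y²≡ = trans (cong₂ _*_ (sym ∣x∣≡y) (sym ∣x∣≡y)) (trans (sym (i*i≡∣i∣ᶻ*∣i∣ᶻ x)) x²≡)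
  ring : ∀ a e → + 4 * e ≡ (a + + 4 * e) - a
  ring = solve-∀
  4*unit≢0 : ∀ {e} → Unit e → + 4 * e ≢ 0ℤ
  4*unit≢0 (inj₁ refl) ()
  4*unit≢0 (inj₂ refl) ()
... | tri> _ _ y<∣x∣ = ℤP.<-irrefl (sym x²≡) (begin-strict
  y * y + + 4 * e         <⟨ <-by gap (ring y e) 0≤gap ⟩
  (y + + 1) * (y + + 1)   ≤⟨ *-self-mono-≤ (ℤP.≤-trans (0≤+ 3) (ℤP.≤-trans 3≤y (ℤP.i≤i+j y (+ 1)))) y+1≤∣x∣ ⟩
  ∣ x ∣ᶻ * ∣ x ∣ᶻ         ≡⟨ sym (i*i≡∣i∣ᶻ*∣i∣ᶻ x) ⟩
  x * x                   ∎)
  where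
  open ℤP.≤-Reasoning
  y+1≤∣x∣ = subst (_≤ ∣ x ∣ᶻ) (ℤP.+-comm (+ 1) y) (ℤP.i<j⇒suc[i]≤j y<∣x∣)
  gap = + 2 + + 2 * (y - + 3) + + 4 * (+ 1 - e)
  0≤gap = +-nonneg (+-nonneg (0≤+ 2) (*-nonneg (0≤+ 2) (ℤP.i≤j⇒0≤j-i 3≤y))) (*-nonneg (0≤+ 4) (proj₂ (Unit-bounds e-unit)))
  ring : ∀ y e → (y + + 1) * (y + + 1) ≡ y * y + + 4 * e + (+ 2 + + 2 * (y - + 3) + + 4 * (+ 1 - e)) + + 1
  ring = solve-∀

i≤∣i∣ᶻ : ∀ i → i ≤ ∣ i ∣ᶻ
i≤∣i∣ᶻ (+ n)    = ℤP.≤-refl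
i≤∣i∣ᶻ -[1+ n ] = ℤ.-≤+

0≤i+∣i∣ᶻ : ∀ i → 0ℤ ≤ i + ∣ i ∣ᶻ
0≤i+∣i∣ᶻ (+ n)    = 0≤+ (n ℕ.+ n)
0≤i+∣i∣ᶻ -[1+ n ] = ℤP.≤-reflexive (sym (ℤP.+-inverseˡ (+ suc n)))

list-bound : List ℤ → ℤ
list-bound []       = 0ℤ
list-bound (k ∷ ks) = ∣ k ∣ᶻ + list-bound ks

0≤list-bound : ∀ ks → 0ℤ ≤ list-bound ks
0≤list-bound []       = ℤP.≤-refl
0≤list-bound (k ∷ ks) = +-nonneg (∣∣ᶻ-nonneg k) (0≤list-bound ks)

≤list-bound : ∀ ks → All (_≤ list-bound ks) ks
≤list-bound []       = []
≤list-bound (k ∷ ks) =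
  ℤP.≤-trans (i≤∣i∣ᶻ k) (≤-by (list-bound ks) refl (0≤list-bound ks)) ∷
  All.map (λ k′≤ → ℤP.≤-trans k′≤ (≤-by ∣ k ∣ᶻ (ℤP.+-comm ∣ k ∣ᶻ (list-bound ks)) (∣∣ᶻ-nonneg k))) (≤list-bound ks)

*-cancelˡ-≡-pos : ∀ {k i j} → + 1 ≤ k → k * i ≡ k * j → i ≡ j
*-cancelˡ-≡-pos {+[1+ m ]} {i} {j} _ = ℤP.*-cancelˡ-≡ +[1+ m ] i j
*-cancelˡ-≡-pos {+ 0} (ℤ.+≤+ ())

sum-<-square : ∀ {A m W q} → 0ℤ ≤ A → 0ℤ ≤ m → 0ℤ ≤ W → + 2 * A < q → + 2 * m * W < q → A + m * (q * W) < q * q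
sum-<-square {A} {m} {W} {q} 0≤A 0≤m 0≤W 2A<q 2mW<q = <-by gap (ring A m W q)
  (+-nonneg (+-nonneg (ℤP.i≤j⇒0≤j-i (ℤP.i<j⇒suc[i]≤j 2A<q)) (*-nonneg (ℤP.i≤j⇒0≤j-i (ℤP.i<j⇒suc[i]≤j 2mW<q)) 0≤q))
            (+-nonneg 0≤A (*-nonneg 0≤m (*-nonneg 0≤q 0≤W))))
  where
  0≤q = ℤP.<⇒≤ (ℤP.≤-<-trans (*-nonneg (0≤+ 2) 0≤A) 2A<q)
  gap = (q - (+ 1 + + 2 * A)) + (q - (+ 1 + + 2 * m * W)) * q + (A + m * (q * W))
  ring : ∀ A m W q → q * q ≡ A + m * (q * W) + ((q - (+ 1 + + 2 * A)) + (q - (+ 1 + + 2 * m * W)) * q + (A + m * (q * W))) + + 1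
  ring = solve-∀

rational-root-of-monic-quadratic-is-integral : ∀ B C r →
  ℚ.↥ r * ℚ.↥ r + B * ℚ.↥ r * ℚ.↧ r + C * ℚ.↧ r * ℚ.↧ r ≡ 0ℤ → ℚ.↧ₙ r ≡ 1
rational-root-of-monic-quadratic-is-integral B C (ℚ.mkℚ u d-1 coprime) root =
  Coprime.recompute coprime (d∣u , ∣-refl)
  where
  d = + suc d-1
  w = B * u + C * d
  u²≡d·-w : u * u ≡ d * (- w)
  u²≡d·-w = trans (ring u d B C) (trans (cong (λ z → z - d * w) root) (ring′ d w))
    where
    ring′ : ∀ d w → 0ℤ - d * w ≡ d * (- w)
    ring′ = solve-∀
    ring : ∀ u d B C → u * u ≡ (u * u + B * u * d + C * d * d) - d * (B * u + C * d)
    ring = solve-∀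
  d∣u : suc d-1 ∣ ∣ u ∣
  d∣u = Coprime.coprime-divisor (Coprime.sym (Coprime.recompute coprime))
          (divides ∣ - w ∣ (trans (sym (ℤP.abs-* u u)) (trans (cong ∣_∣ u²≡d·-w) (trans (ℤP.abs-* d (- w)) (ℕP.*-comm (suc d-1) _)))))

-- 2×2 matrices and continued fractions

record Mat : Set where
  constructor mat
  field m11 m12 m21 m22 : ℤ
open Mat

infixl 7 _⊗_
_⊗_ : Mat → Mat → Mat
mat a b c d ⊗ mat e f g h = mat (a * e + b * g) (a * f + b * h) (c * e + d * g) (c * f + d * h)

I : Mat
I = mat (+ 1) (+ 0) (+ 0) (+ 1)

-- the matrix of the Möbius map x ↦ a + 1/x
A : ℤ → Mat
A a = mat a (+ 1) (+ 1) (+ 0)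

transpose : Mat → Mat
transpose (mat a b c d) = mat a c b d

det : Mat → ℤ
det (mat a b c d) = a * d - b * c

mat-cong : ∀ {a b c d a′ b′ c′ d′} → a ≡ a′ → b ≡ b′ → c ≡ c′ → d ≡ d′ →
           mat a b c d ≡ mat a′ b′ c′ d′
mat-cong refl refl refl refl = refl

⊗-assoc : ∀ X Y Z → (X ⊗ Y) ⊗ Z ≡ X ⊗ (Y ⊗ Z)
⊗-assoc (mat a b c d) (mat e f g h) (mat i j k l) =
  mat-cong (entry a b e f g h i k) (entry a b e f g h j l) (entry c d e f g h i k) (entry c d e f g h j l)
  where
  entry : ∀ a b e f g h i k →
          (a * e + b * g) * i + (a * f + b * h) * k ≡ a * (e * i + f * k) + b * (g * i + h * k)
  entry = solve-∀

⊗-identityʳ : ∀ X → X ⊗ I ≡ X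
⊗-identityʳ (mat a b c d) = mat-cong (left a b) (right a b) (left c d) (right c d)
  where
  left : ∀ a b → a * + 1 + b * + 0 ≡ a
  left = solve-∀
  right : ∀ a b → a * + 0 + b * + 1 ≡ b
  right = solve-∀

⊗-identityˡ : ∀ X → I ⊗ X ≡ X
⊗-identityˡ (mat a b c d) = mat-cong (top a c) (top b d) (bottom a c) (bottom b d)
  where
  top : ∀ a c → + 1 * a + + 0 * c ≡ a
  top = solve-∀
  bottom : ∀ a c → + 0 * a + + 1 * c ≡ c
  bottom = solve-∀

transpose-⊗ : ∀ X Y → transpose (X ⊗ Y) ≡ transpose Y ⊗ transpose X
transpose-⊗ (mat a b c d) (mat e f g h) = mat-cong (entry a b e g) (entry c d e g) (entry a b f h) (entry c d f h)
  where
  entry : ∀ a b e g → a * e + b * g ≡ e * a + g * b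
  entry = solve-∀

det-⊗ : ∀ X Y → det (X ⊗ Y) ≡ det X * det Y
det-⊗ (mat a b c d) (mat e f g h) = cauchy-binet a b c d e f g h
  where
  cauchy-binet : ∀ a b c d e f g h →
    (a * e + b * g) * (c * f + d * h) - (a * f + b * h) * (c * e + d * g) ≡ (a * d - b * c) * (e * h - f * g)
  cauchy-binet = solve-∀

⊗-A : ∀ X a → X ⊗ A a ≡ mat (m11 X * a + m12 X) (m11 X) (m21 X * a + m22 X) (m21 X)
⊗-A X a = mat-cong (new (m11 X) (m12 X) a) (old (m11 X) (m12 X)) (new (m21 X) (m22 X) a) (old (m21 X) (m22 X))
  where
  new : ∀ x y a → x * a + y * + 1 ≡ x * a + y
  new = solve-∀
  old : ∀ x y → x * + 1 + y * + 0 ≡ x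
  old = solve-∀

det-A : ∀ a → det (A a) ≡ - + 1
det-A a = ring a
  where
  ring : ∀ a → a * + 0 - + 1 * + 1 ≡ - + 1
  ring = solve-∀

∏A : ℕ → (ℕ → ℤ) → Mat
∏A zero    c = I
∏A (suc m) c = A (c 0) ⊗ ∏A m (λ i → c (suc i))

∏A-cong : ∀ m {c d} → (∀ i → i ℕ.< m → c i ≡ d i) → ∏A m c ≡ ∏A m d
∏A-cong zero    c≡d = refl
∏A-cong (suc m) c≡d = cong₂ (λ a X → A a ⊗ X) (c≡d 0 (ℕ.s≤s ℕ.z≤n)) (∏A-cong m (λ i i<m → c≡d (suc i) (ℕ.s≤s i<m)))

∏A-+ : ∀ m k c → ∏A (m ℕ.+ k) c ≡ ∏A m c ⊗ ∏A k (λ i → c (m ℕ.+ i))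
∏A-+ zero    k c = sym (⊗-identityˡ _)
∏A-+ (suc m) k c = trans (cong (A (c 0) ⊗_) (∏A-+ m k (λ i → c (suc i))))
                         (sym (⊗-assoc (A (c 0)) _ _))

∏A-suc : ∀ m c → ∏A (suc m) c ≡ ∏A m c ⊗ A (c m)
∏A-suc m c = begin
  ∏A (suc m) c                    ≡⟨ cong (λ k → ∏A k c) (ℕP.+-comm 1 m) ⟩
  ∏A (m ℕ.+ 1) c                  ≡⟨ ∏A-+ m 1 c ⟩
  ∏A m c ⊗ (A (c (m ℕ.+ 0)) ⊗ I)  ≡⟨ cong (∏A m c ⊗_) (⊗-identityʳ _) ⟩
  ∏A m c ⊗ A (c (m ℕ.+ 0))        ≡⟨ cong (λ i → ∏A m c ⊗ A (c i)) (ℕP.+-identityʳ m) ⟩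
  ∏A m c ⊗ A (c m)                ∎
  where open ≡-Reasoning

∏A-suc-entries : ∀ m c → let X = ∏A m c in
  ∏A (suc m) c ≡ mat (m11 X * c m + m12 X) (m11 X) (m21 X * c m + m22 X) (m21 X)
∏A-suc-entries m c = trans (∏A-suc m c) (⊗-A (∏A m c) (c m))

transpose-∏A : ∀ m c → transpose (∏A m c) ≡ ∏A m (λ i → c (m ℕ.∸ suc i))
transpose-∏A zero    c = refl
transpose-∏A (suc m) c = begin
  transpose (A (c 0) ⊗ ∏A m c′)                 ≡⟨ transpose-⊗ (A (c 0)) (∏A m c′) ⟩
  transpose (∏A m c′) ⊗ A (c 0)                 ≡⟨ cong (_⊗ A (c 0)) (transpose-∏A m c′) ⟩
  ∏A m (λ i → c′ (m ℕ.∸ suc i)) ⊗ A (c 0)       ≡⟨ cong₂ _⊗_ (∏A-cong m (λ i i<m → cong c (suc-∸ i<m)))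
                                                               (cong (λ k → A (c k)) (sym (ℕP.n∸n≡0 m))) ⟩
  ∏A m (λ i → c (m ℕ.∸ i)) ⊗ A (c (m ℕ.∸ m))    ≡⟨ sym (∏A-suc m (λ i → c (suc m ℕ.∸ suc i))) ⟩
  ∏A (suc m) (λ i → c (suc m ℕ.∸ suc i))        ∎
  where
  open ≡-Reasoning
  c′ = λ i → c (suc i)
  suc-∸ : ∀ {m i} → i ℕ.< m → suc (m ℕ.∸ suc i) ≡ m ℕ.∸ i
  suc-∸ {m} i<m = sym (ℕP.+-∸-assoc 1 i<m)

det-∏A : ∀ m c → Unit (det (∏A m c))
det-∏A zero    c = inj₁ refl
det-∏A (suc m) c with det-∏A m (λ i → c (suc i))
... | inj₁ d≡1  = inj₂ (trans (det-⊗ (A (c 0)) _) (cong₂ _*_ (det-A (c 0)) d≡1))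
... | inj₂ d≡-1 = inj₁ (trans (det-⊗ (A (c 0)) _) (cong₂ _*_ (det-A (c 0)) d≡-1))

∏A-2 : ∀ c → ∏A 2 c ≡ mat (c 0 * c 1 + + 1) (c 0) (c 1) (+ 1)
∏A-2 c = trans (cong (A (c 0) ⊗_) (⊗-identityʳ (A (c 1)))) (mat-cong (ring₁ (c 0) (c 1)) (ring₂ (c 0)) (ring₃ (c 1)) refl)
  where
  ring₁ : ∀ x y → x * y + + 1 * + 1 ≡ x * y + + 1
  ring₁ = solve-∀
  ring₂ : ∀ x → x * + 1 + + 1 * + 0 ≡ x
  ring₂ = solve-∀
  ring₃ : ∀ y → + 1 * y + + 0 * + 1 ≡ y
  ring₃ = solve-∀

∏A-3 : ∀ c → ∏A 3 c ≡ mat ((c 0 * c 1 + + 1) * c 2 + c 0) (c 0 * c 1 + + 1) (c 1 * c 2 + + 1) (c 1)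
∏A-3 c = trans (∏A-suc-entries 2 c) (cong (λ T → mat (m11 T * c 2 + m12 T) (m11 T) (m21 T * c 2 + m22 T) (m21 T)) (∏A-2 c))

recur-⊗ : ∀ b u v j → let Π = ∏A (suc j) b in
  recur b u v j ≡ (u * m11 Π + v * m21 Π , u * m12 Π + v * m22 Π)
recur-⊗ b u v zero = cong₂ _,_ (first (b 0) u v) (second (b 0) u v)
  where
  first : ∀ a u v → a * u + v ≡ u * (a * + 1 + + 1 * + 0) + v * (+ 1 * + 1 + + 0 * + 0)
  first = solve-∀
  second : ∀ a u v → u ≡ u * (a * + 0 + + 1 * + 1) + v * (+ 1 * + 0 + + 0 * + 1)
  second = solve-∀
recur-⊗ b u v (suc j) with recur b u v j | recur-⊗ b u v j
... | _ | refl = cong₂ _,_ (trans (ring a u v (m11 Π) (m12 Π) (m21 Π) (m22 Π)) (cong (λ X → u * m11 X + v * m21 X) Π′≡))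
                           (cong (λ X → u * m12 X + v * m22 X) Π′≡)
  where
  Π = ∏A (suc j) b
  a = b (suc j)
  Π′≡ : mat (m11 Π * a + m12 Π) (m11 Π) (m21 Π * a + m22 Π) (m21 Π) ≡ ∏A (suc (suc j)) b
  Π′≡ = sym (∏A-suc-entries (suc j) b)
  ring : ∀ a u v x y z w → a * (u * x + v * z) + (u * y + v * w) ≡ u * (x * a + y) + v * (z * a + w)
  ring = solve-∀

num≡ : ∀ b j → let T = ∏A j (λ i → b (suc i)) in num b j ≡ b 0 * m11 T + m21 T
num≡ b j = trans (cong proj₁ (recur-⊗ b (+ 1) (+ 0) j)) (ring (b 0) (m11 T) (m21 T) (m12 T) (m22 T))
  where
  T = ∏A j (λ i → b (suc i))
  ring : ∀ a x z y w → + 1 * (a * x + + 1 * z) + + 0 * (+ 1 * x + + 0 * z) ≡ a * x + z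
  ring = solve-∀

den≡ : ∀ b j → den b j ≡ m11 (∏A j (λ i → b (suc i)))
den≡ b j = trans (cong proj₁ (recur-⊗ b (+ 0) (+ 1) j)) (ring (b 0) (m11 T) (m21 T))
  where
  T = ∏A j (λ i → b (suc i))
  ring : ∀ a x z → + 0 * (a * x + + 1 * z) + + 1 * (+ 1 * x + + 0 * z) ≡ x
  ring = solve-∀

Growing : ℕ → Mat → Set
Growing j T = (+ 1 ≤ m11 T) × (0ℤ ≤ m12 T) × (m12 T ≤ m11 T) × (+ suc j ≤ m11 T + m12 T)

Growing-step : ∀ {j x y z w c} → + 1 ≤ c → Growing j (mat x y z w) → Growing (suc j) (mat (x * c + y) x (z * c + w) z)
Growing-step {j} {x} {y} {c = c} 1≤c (1≤x , 0≤y , y≤x , j<x+y) =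
    ≤-by ((x - + 1) * c + (c - + 1) + y) (ring₁ x y c)
         (+-nonneg (+-nonneg (*-nonneg (ℤP.i≤j⇒0≤j-i 1≤x) (1≤⇒0≤ 1≤c)) (ℤP.i≤j⇒0≤j-i 1≤c)) 0≤y)
  , 1≤⇒0≤ 1≤x
  , ≤-by (x * (c - + 1) + y) (ring₂ x y c) (+-nonneg (*-nonneg (1≤⇒0≤ 1≤x) (ℤP.i≤j⇒0≤j-i 1≤c)) 0≤y)
  , ≤-by (x * (c - + 1) + (x + y - + suc j) + (x - + 1)) (ring₃ x y c (+ suc j))
         (+-nonneg (+-nonneg (*-nonneg (1≤⇒0≤ 1≤x) (ℤP.i≤j⇒0≤j-i 1≤c)) (ℤP.i≤j⇒0≤j-i j<x+y)) (ℤP.i≤j⇒0≤j-i 1≤x))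
  where
  ring₁ : ∀ x y c → x * c + y ≡ + 1 + ((x - + 1) * c + (c - + 1) + y)
  ring₁ = solve-∀
  ring₂ : ∀ x y c → x * c + y ≡ x + (x * (c - + 1) + y)
  ring₂ = solve-∀
  ring₃ : ∀ x y c s → x * c + y + x ≡ (+ 1 + s) + (x * (c - + 1) + (x + y - s) + (x - + 1))
  ring₃ = solve-∀

∏A-growing : ∀ {c} → (∀ i → + 1 ≤ c i) → ∀ j → Growing j (∏A j c)
∏A-growing c≥1 zero    = ℤP.≤-refl , 0≤+ 0 , 0≤+ 1 , ℤP.≤-refl
∏A-growing {c} c≥1 (suc j) = subst (Growing (suc j)) (sym (∏A-suc-entries j c))
  (Growing-step {z = m21 (∏A j c)} {w = m22 (∏A j c)} (c≥1 j) (∏A-growing c≥1 j))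

1≤m12-∏A-suc : ∀ {c} → (∀ i → + 1 ≤ c i) → ∀ m → + 1 ≤ m12 (∏A (suc m) c)
1≤m12-∏A-suc {c} c≥1 m = subst (λ T → + 1 ≤ m12 T) (sym (∏A-suc-entries m c)) (proj₁ (∏A-growing c≥1 m))

RowsOrdered : Mat → Set
RowsOrdered T = (0ℤ ≤ m21 T) × (m21 T ≤ m11 T) × (0ℤ ≤ m22 T) × (m22 T ≤ m12 T)

∏A-rows-ordered : ∀ {c} → (∀ i → + 1 ≤ c i) → ∀ j → RowsOrdered (∏A (suc j) c)
∏A-rows-ordered {c} c≥1 zero = subst RowsOrdered (sym (∏A-suc-entries 0 c))
  (0≤+ 1 , subst (+ 1 ≤_) (ring (c 0)) (c≥1 0) , 0≤+ 0 , 0≤+ 1)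
  where
  ring : ∀ x → x ≡ + 1 * x + + 0
  ring = solve-∀
∏A-rows-ordered {c} c≥1 (suc j) = subst RowsOrdered (sym (∏A-suc-entries (suc j) c)) (step (∏A-rows-ordered c≥1 j))
  where
  T = ∏A (suc j) c
  0≤c = 1≤⇒0≤ (c≥1 (suc j))
  step : RowsOrdered T → RowsOrdered (mat (m11 T * c (suc j) + m12 T) (m11 T) (m21 T * c (suc j) + m22 T) (m21 T))
  step (0≤z , z≤x , 0≤w , w≤y) = +-nonneg (*-nonneg 0≤z 0≤c) 0≤w , ℤP.+-mono-≤ (*-monoʳ-≤-nonneg 0≤c z≤x) w≤y , 0≤z , z≤x

0≤m21≤m11-∏A : ∀ {c} → (∀ i → + 1 ≤ c i) → ∀ j → (0ℤ ≤ m21 (∏A j c)) × (m21 (∏A j c) ≤ m11 (∏A j c))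
0≤m21≤m11-∏A c≥1 zero    = 0≤+ 0 , 0≤+ 1
0≤m21≤m11-∏A c≥1 (suc j) with ∏A-rows-ordered c≥1 j
... | 0≤z , z≤x , _ = 0≤z , z≤x

NonnegForm : ℤ → ℤ → Mat → Set
NonnegForm α β T = (0ℤ ≤ α * m11 T + β * m21 T) × (0ℤ ≤ α * m12 T + β * m22 T)

∏A-NonnegForm : ∀ {c} → (∀ i → + 1 ≤ c i) → ∀ α β {m j} → m ℕ.≤ j → NonnegForm α β (∏A m c) → NonnegForm α β (∏A j c)
∏A-NonnegForm {c} c≥1 α β {m} m≤j form≥0 = subst (λ k → NonnegForm α β (∏A k c)) (ℕP.m∸n+n≡m m≤j) (persist (_ ℕ.∸ m))
  where
  persist : ∀ d → NonnegForm α β (∏A (d ℕ.+ m) c)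
  persist zero    = form≥0
  persist (suc d) = subst (NonnegForm α β) (sym (∏A-suc-entries (d ℕ.+ m) c)) (step (persist d))
    where
    T = ∏A (d ℕ.+ m) c
    x = c (d ℕ.+ m)
    step : NonnegForm α β T → NonnegForm α β (mat (m11 T * x + m12 T) (m11 T) (m21 T * x + m22 T) (m21 T))
    step (first≥0 , second≥0) =
      subst (0ℤ ≤_) (sym (ring α β (m11 T) (m12 T) (m21 T) (m22 T) x)) (+-nonneg (*-nonneg (1≤⇒0≤ (c≥1 (d ℕ.+ m))) first≥0) second≥0) , first≥0
      where
      ring : ∀ α β a b c d x → α * (a * x + b) + β * (c * x + d) ≡ x * (α * a + β * c) + (α * b + β * d)
      ring = solve-∀

-- Rationals as fractions of integers

infix 4 _≐_÷_

_≐_÷_ : ℚ → ℤ → ℤ → Set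
x ≐ p ÷ +[1+ k ] = toℚᵘ x ≃ mkℚᵘ p k
x ≐ p ÷ _        = ⊥

≐-+ : ∀ {x y a b c d} → x ≐ a ÷ b → y ≐ c ÷ d → x ℚ.+ y ≐ a * d + c * b ÷ b * d
≐-+ {x} {y} {b = +[1+ _ ]} {d = +[1+ _ ]} x≐ y≐ = UP.≃-trans (ℚP.toℚᵘ-homo-+ x y) (UP.+-cong x≐ y≐)

≐-* : ∀ {x y a b c d} → x ≐ a ÷ b → y ≐ c ÷ d → x ℚ.* y ≐ a * c ÷ b * d
≐-* {x} {y} {b = +[1+ _ ]} {d = +[1+ _ ]} x≐ y≐ = UP.≃-trans (ℚP.toℚᵘ-homo-* x y) (UP.*-cong x≐ y≐)

≐-≤ : ∀ {x y a b c d} → x ≐ a ÷ b → y ≐ c ÷ d → a * d ≤ c * b → x ℚ.≤ y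
≐-≤ {x} {y} {b = +[1+ _ ]} {d = +[1+ _ ]} x≐ y≐ ad≤cb =
  ℚP.toℚᵘ-cancel-≤ (UP.≤-respʳ-≃ (UP.≃-sym y≐) (UP.≤-respˡ-≃ (UP.≃-sym x≐) (*≤* ad≤cb)))

≐-< : ∀ {x y a b c d} → x ≐ a ÷ b → y ≐ c ÷ d → a * d < c * b → x ℚ.< y
≐-< {x} {y} {b = +[1+ _ ]} {d = +[1+ _ ]} x≐ y≐ ad<cb =
  ℚP.toℚᵘ-cancel-< (UP.<-respʳ-≃ (UP.≃-sym y≐) (UP.<-respˡ-≃ (UP.≃-sym x≐) (*<* ad<cb)))

≐-<⁻¹ : ∀ {x y a b c d} → x ≐ a ÷ b → y ≐ c ÷ d → x ℚ.< y → a * d < c * b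
≐-<⁻¹ {x} {y} {b = +[1+ _ ]} {d = +[1+ _ ]} x≐ y≐ x<y with UP.<-respʳ-≃ y≐ (UP.<-respˡ-≃ x≐ (ℚP.toℚᵘ-mono-< x<y))
... | *<* ad<cb = ad<cb

≐-neg : ∀ {x a b} → x ≐ a ÷ b → ℚ.- x ≐ - a ÷ b
≐-neg {x} {b = +[1+ _ ]} x≐ = UP.≃-trans (ℚP.toℚᵘ-homo‿- x) (UP.-‿cong x≐)

≐-- : ∀ {x y a b c d} → x ≐ a ÷ b → y ≐ c ÷ d → x ℚ.- y ≐ a * d - c * b ÷ b * d
≐-- {x} {y} {a} {b} {c} {d} x≐ y≐ =
  subst (λ z → x ℚ.- y ≐ z ÷ b * d) (cong (λ z → a * d + z) (sym (ℤP.neg-distribˡ-* c b))) (≐-+ x≐ (≐-neg y≐))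

≐-∣∣ : ∀ {x a b} → x ≐ a ÷ b → ℚ.∣ x ∣ ≐ + ∣ a ∣ ÷ b
≐-∣∣ {x} {b = +[1+ _ ]} x≐ = UP.≃-trans (ℚP.toℚᵘ-homo-∣-∣ x) (UP.∣-∣-cong x≐)

≐-rescale : ∀ {x a b a′ b′} → x ≐ a ÷ b → + 1 ≤ b′ → a * b′ ≡ a′ * b → x ≐ a′ ÷ b′
≐-rescale {b = +[1+ _ ]} {b′ = +[1+ _ ]} x≐ _ ab′≡a′b = UP.≃-trans x≐ (*≡* ab′≡a′b)
≐-rescale {b = +[1+ _ ]} {b′ = + 0} _ (ℤ.+≤+ ()) _

frac-≐ : ∀ p {q} → + 1 ≤ q → frac p q ≐ p ÷ q
frac-≐ p {+[1+ k ]} _ = ℚP.toℚᵘ-fromℚᵘ (mkℚᵘ p k)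
frac-≐ p {+ 0} (ℤ.+≤+ ())

fromℤ-≐ : ∀ z → fromℤ z ≐ z ÷ + 1
fromℤ-≐ z = ℚP.toℚᵘ-fromℚᵘ (mkℚᵘ z 0)

0≐ : 0ℚ ≐ 0ℤ ÷ + 1
0≐ = UP.≃-refl

1≐ : 1ℚ ≐ + 1 ÷ + 1
1≐ = UP.≃-refl

↥÷↧ : ∀ x → x ≐ ℚ.↥ x ÷ ℚ.↧ x
↥÷↧ (ℚ.mkℚ _ _ _) = UP.≃-refl

1≤↥ : ∀ {ε} → ℚ.Positive ε → + 1 ≤ ℚ.↥ ε
1≤↥ {ℚ.mkℚ +[1+ _ ] _ _} _ = ℤ.+≤+ (ℕ.s≤s ℕ.z≤n)

1/q-positive : ∀ {q} → + 1 ≤ q → ℚ.Positive (frac (+ 1) q)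
1/q-positive {q} 1≤q = ℚ.positive (≐-< 0≐ (frac-≐ (+ 1) 1≤q) (subst (_< + 1) (sym (ℤP.*-zeroˡ q)) (ℤ.+<+ (ℕ.s≤s ℕ.z≤n))))

∑∣_∣ : (ℕ → ℤ) → ℕ → ℕ
∑∣ f ∣ zero    = 0
∑∣ f ∣ (suc k) = ∑∣ f ∣ k ℕ.+ ∣ f k ∣

∣f∣≤∑∣f∣ : ∀ f {i k} → i ℕ.< k → ∣ f i ∣ ℕ.≤ ∑∣ f ∣ k
∣f∣≤∑∣f∣ f {i} {suc k} i<1+k with ℕP.m≤n⇒m<n∨m≡n (ℕP.≤-pred i<1+k)
... | inj₁ i<k  = ℕP.≤-trans (∣f∣≤∑∣f∣ f i<k) (ℕP.m≤m+n (∑∣ f ∣ k) _)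
... | inj₂ refl = ℕP.m≤n+m _ (∑∣ f ∣ k)

bounded-if-periodic-up-to-sign : ∀ f L .{{_ : NonZero L}} → (∀ j → ∣ f (L ℕ.+ j) ∣ ≡ ∣ f j ∣) →
                                 ∀ j → ∣ f j ∣ ℕ.≤ ∑∣ f ∣ L
bounded-if-periodic-up-to-sign f L periodic j = subst (λ i → ∣ f i ∣ ℕ.≤ ∑∣ f ∣ L) (sym (m≡m%n+[m/n]*n j L)) ∣f-j∣≤
  where
  shift : ∀ i k → ∣ f (i ℕ.+ k ℕ.* L) ∣ ≡ ∣ f i ∣
  shift i zero    = cong (λ m → ∣ f m ∣) (ℕP.+-identityʳ i)
  shift i (suc k) = trans (cong (λ m → ∣ f m ∣) (x∙yz≈y∙xz ℕP.+-commutativeSemigroup i L (k ℕ.* L)))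
                          (trans (periodic (i ℕ.+ k ℕ.* L)) (shift i k))
  ∣f-j∣≤ = subst (ℕ._≤ ∑∣ f ∣ L) (sym (shift (j % L) (j / L))) (∣f∣≤∑∣f∣ f (m%n<n j L))

-- The continued fraction [a₀; \overline{a₁, …, a_n, t}]

snoc-< : ∀ {n} (a : Fin n → ℤ) t (k : Fin (suc n)) (k<n : toℕ k ℕ.< n) → snoc a t k ≡ a (fromℕ< k<n)
snoc-< {suc n} a t fzero    _           = refl
snoc-< {suc n} a t (fsuc k) (ℕ.s≤s k<n) = snoc-< (λ j → a (fsuc j)) t k k<n

snoc-last : ∀ {n} (a : Fin n → ℤ) t (k : Fin (suc n)) → toℕ k ≡ n → snoc a t k ≡ t
snoc-last {zero}  a t fzero    _    = refl
snoc-last {suc n} a t (fsuc k) k≡n = snoc-last (λ j → a (fsuc j)) t k (ℕP.suc-injective k≡n)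

snoc-all : ∀ {n} (P : ℤ → Set) (a : Fin n → ℤ) t → (∀ i → P (a i)) → P t → ∀ k → P (snoc a t k)
snoc-all {zero}  P a t Pa Pt fzero    = Pt
snoc-all {suc n} P a t Pa Pt fzero    = Pa fzero
snoc-all {suc n} P a t Pa Pt (fsuc k) = snoc-all P (λ j → a (fsuc j)) t (λ j → Pa (fsuc j)) Pt k

module Block {n : ℕ} (a : Fin n → ℤ) where

  L : ℕ
  L = suc n

  -- block t i is the partial quotient b (suc i) of [b₀; \overline{a₁, …, a_n, t}]
  block : ℤ → ℕ → ℤ
  block t i = snoc a t (i mod L)

  toℕ-mod : ∀ {i} → i ℕ.< L → toℕ (i mod L) ≡ i
  toℕ-mod i<L = trans (FP.toℕ-fromℕ< _) (m<n⇒m%n≡m i<L)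

  block-< : ∀ t {i} (i<n : i ℕ.< n) → block t i ≡ a (fromℕ< i<n)
  block-< t {i} i<n = trans (snoc-< a t (i mod L) k<n) (cong a (FP.toℕ-injective toℕ-k≡i))
    where
    i≡toℕ-k = sym (toℕ-mod (ℕP.m<n⇒m<1+n i<n))
    k<n = subst (ℕ._< n) i≡toℕ-k i<n
    toℕ-k≡i = trans (FP.toℕ-fromℕ< k<n) (trans (sym i≡toℕ-k) (sym (FP.toℕ-fromℕ< i<n)))

  block-last : ∀ t → block t n ≡ t
  block-last t = snoc-last a t (n mod L) (toℕ-mod (ℕP.n<1+n n))

  block-periodic : ∀ t i → block t (L ℕ.+ i) ≡ block t i
  block-periodic t i = cong (snoc a t) (FP.toℕ-injective (begin
    toℕ ((L ℕ.+ i) mod L)  ≡⟨ FP.toℕ-fromℕ< _ ⟩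
    (L ℕ.+ i) % L          ≡⟨ cong (_% L) (ℕP.+-comm L i) ⟩
    (i ℕ.+ L) % L          ≡⟨ [m+n]%n≡m%n i L ⟩
    i % L                  ≡⟨ sym (FP.toℕ-fromℕ< _) ⟩
    toℕ (i mod L)          ∎))
    where open ≡-Reasoning

  block-all : ∀ (P : ℤ → Set) t → (∀ i → P (a i)) → P t → ∀ i → P (block t i)
  block-all P t Pa Pt i = snoc-all P a t Pa Pt (i mod L)

  -- the choice t = + 1 is immaterial, see ∏A-block
  M : Mat
  M = ∏A n (block (+ 1))

  ∏A-block : ∀ t → ∏A n (block t) ≡ M
  ∏A-block t = ∏A-cong n (λ i i<n → trans (block-< t i<n) (sym (block-< (+ 1) i<n)))

  P Q R : ℤ
  P = m11 M
  Q = m12 M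
  R = m22 M

  e : ℤ
  e = P * R - Q * Q

module PeriodicCF {n : ℕ} (a : Fin n → ℤ) (a≥1 : ∀ i → + 1 ≤ a i) (pal : ∀ i → a i ≡ a (opposite i)) where

  open Block a public

  block≥1 : ∀ i → + 1 ≤ block (+ 1) i
  block≥1 = block-all (+ 1 ≤_) (+ 1) a≥1 ℤP.≤-refl

  P≥1 : + 1 ≤ P
  P≥1 = proj₁ (∏A-growing block≥1 n)

  0≤Q : 0ℤ ≤ Q
  0≤Q = proj₁ (proj₂ (∏A-growing block≥1 n))

  Q≥1 : 1 ℕ.≤ n → + 1 ≤ Q
  Q≥1 (ℕ.s≤s {n = m} _) = 1≤m12-∏A-suc block≥1 m

  block-reverse : ∀ {i} → i ℕ.< n → block (+ 1) i ≡ block (+ 1) (n ℕ.∸ suc i)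
  block-reverse {i} i<n = begin
    block (+ 1) i               ≡⟨ block-< (+ 1) i<n ⟩
    a (fromℕ< i<n)              ≡⟨ pal (fromℕ< i<n) ⟩
    a (opposite (fromℕ< i<n))   ≡⟨ cong a (FP.toℕ-injective toℕ-opposite) ⟩
    a (fromℕ< n-1-i<n)          ≡⟨ sym (block-< (+ 1) n-1-i<n) ⟩
    block (+ 1) (n ℕ.∸ suc i)   ∎
    where
    open ≡-Reasoning
    n-1-i<n = ℕP.∸-monoʳ-< {n} {suc i} {0} (ℕ.s≤s ℕ.z≤n) i<n
    toℕ-opposite = trans (FP.opposite-prop (fromℕ< i<n))
                    (trans (cong (λ k → n ℕ.∸ suc k) (FP.toℕ-fromℕ< i<n)) (sym (FP.toℕ-fromℕ< n-1-i<n)))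

  M-symmetric : m21 M ≡ Q
  M-symmetric = cong m12 (trans (transpose-∏A n (block (+ 1))) (∏A-cong n (λ i i<n → sym (block-reverse i<n))))

  e-unit : Unit e
  e-unit = subst (λ z → Unit (P * R - Q * z)) M-symmetric (det-∏A n (block (+ 1)))

  1≤P[t+1]+Q : ∀ {t} → + 1 ≤ t → + 1 ≤ P * (t + + 1) + Q
  1≤P[t+1]+Q {t} 1≤t = ≤-by (P * t + (P - + 1) + Q) (ring P t Q)
    (+-nonneg (+-nonneg (1≤⇒0≤ (1≤* P≥1 1≤t)) (ℤP.i≤j⇒0≤j-i P≥1)) 0≤Q)
    where
    ring : ∀ P t Q → P * (t + + 1) + Q ≡ + 1 + (P * t + (P - + 1) + Q)
    ring = solve-∀

  module Convergents (a₀ t : ℤ) (1≤t : + 1 ≤ t) where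

    b : ℕ → ℤ
    b = periodicCF a₀ L (snoc a t)

    c≥1 : ∀ i → + 1 ≤ block t i
    c≥1 = block-all (+ 1 ≤_) t a≥1 1≤t

    T : ℕ → Mat
    T j = ∏A j (block t)

    X Y : ℕ → ℤ
    X j = m11 (T j)
    Y j = m21 (T j)

    p q : ℕ → ℤ
    p = num b
    q = den b

    p≡ : ∀ j → p j ≡ a₀ * X j + Y j
    p≡ = num≡ b

    q≡ : ∀ j → q j ≡ X j
    q≡ = den≡ b

    T-periodic : ∀ j → T (L ℕ.+ j) ≡ (M ⊗ A t) ⊗ T j
    T-periodic j = begin
      ∏A (L ℕ.+ j) (block t)                                       ≡⟨ ∏A-+ L j (block t) ⟩
      ∏A L (block t) ⊗ ∏A j (λ i → block t (L ℕ.+ i))              ≡⟨ cong₂ _⊗_ T-L (∏A-cong j (λ i _ → block-periodic t i)) ⟩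
      (M ⊗ A t) ⊗ T j                                              ∎
      where
      open ≡-Reasoning
      T-L = trans (∏A-suc n (block t)) (cong₂ (λ U x → U ⊗ A x) (∏A-block t) (block-last t))

    X-periodic : ∀ j → X (L ℕ.+ j) ≡ (P * t + Q) * X j + P * Y j
    X-periodic j = trans (cong m11 (T-periodic j)) (ring P Q t (X j) (Y j))
      where
      ring : ∀ P Q t X Y → (P * t + Q * + 1) * X + (P * + 1 + Q * + 0) * Y ≡ (P * t + Q) * X + P * Y
      ring = solve-∀

    Y-periodic : ∀ j → Y (L ℕ.+ j) ≡ (Q * t + R) * X j + Q * Y j
    Y-periodic j = trans (cong m21 (T-periodic j)) (trans (ring (m21 M) R t (X j) (Y j))
                     (cong (λ z → (z * t + R) * X j + z * Y j) M-symmetric))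
      where
      ring : ∀ Q R t X Y → (Q * t + R * + 1) * X + (Q * + 1 + R * + 0) * Y ≡ (Q * t + R) * X + Q * Y
      ring = solve-∀

    s : ℕ → ℚ
    s = αseq a₀ a t

    1≤q : ∀ j → + 1 ≤ q j
    1≤q j = subst (+ 1 ≤_) (sym (q≡ j)) (proj₁ (∏A-growing c≥1 j))

    s≐ : ∀ j → s j ≐ p j ÷ q j
    s≐ j = frac-≐ (p j) (1≤q j)

    q-large : ∀ K j → K ℕ.+ K ℕ.< j → + K < q j
    q-large K j 2K<j = ℤP.*-cancelˡ-<-nonNeg (+ 2) (begin-strict
      + 2 * + K           ≡⟨ ring (+ K) ⟩
      + K + + K           ≡⟨ ℤP.pos-+ K K ⟨
      + (K ℕ.+ K)         <⟨ ℤ.+<+ (ℕP.m<n⇒m<1+n 2K<j) ⟩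
      + suc j             ≤⟨ ℤP.≤-trans 1+j≤X+Z (ℤP.+-monoʳ-≤ (X j) Z≤X) ⟩
      X j + X j           ≡⟨ cong₂ _+_ (q≡ j) (q≡ j) ⟨
      q j + q j           ≡⟨ ring (q j) ⟨
      + 2 * q j           ∎)
      where
      open ℤP.≤-Reasoning
      growing = ∏A-growing c≥1 j
      Z≤X = proj₁ (proj₂ (proj₂ growing))
      1+j≤X+Z = proj₂ (proj₂ (proj₂ growing))
      ring : ∀ i → + 2 * i ≡ i + i
      ring = solve-∀

    0≤Y : ∀ j → 0ℤ ≤ Y j
    0≤Y j = proj₁ (0≤m21≤m11-∏A c≥1 j)

    Y≤X : ∀ j → Y j ≤ X j
    Y≤X j = proj₂ (0≤m21≤m11-∏A c≥1 j)

    0≤X : ∀ j → 0ℤ ≤ X j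
    0≤X j = ℤP.≤-trans (0≤Y j) (Y≤X j)

    q-after-period≤ : ∀ i → q (L ℕ.+ i) ≤ (P * (t + + 1) + Q) * X i
    q-after-period≤ i = subst (_≤ (P * (t + + 1) + Q) * X i) (sym (trans (q≡ (L ℕ.+ i)) (X-periodic i)))
      (≤-by (P * (X i - Y i)) (ring P Q t (X i) (Y i)) (*-nonneg (1≤⇒0≤ P≥1) (ℤP.i≤j⇒0≤j-i (Y≤X i))))
      where
      ring : ∀ P Q t x y → (P * (t + + 1) + Q) * x ≡ (P * t + Q) * x + P * y + P * (x - y)
      ring = solve-∀

  module Quadratic (a₀ t c′ : ℤ) (1≤t : + 1 ≤ t) (P*c′≡ : P * c′ ≡ t * Q + R) where
    open Convergents a₀ t 1≤t

    form : ℤ → ℤ → ℤ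
    form x y = y * y + t * x * y - c′ * x * x

    Φ : ℕ → ℤ
    Φ j = form (X j) (Y j)

    -- - e = det (M ⊗ A t), the determinant of one period
    Φ-periodic : ∀ j → Φ (L ℕ.+ j) ≡ - e * Φ j
    Φ-periodic j = *-cancelˡ-≡-pos P≥1 (begin
      P * form (X (L ℕ.+ j)) (Y (L ℕ.+ j))
        ≡⟨ cong₂ (λ x y → P * form x y) (X-periodic j) Y-periodic′ ⟩
      P * form ((P * t + Q) * X j + P * Y j) (P * c′ * X j + Q * Y j)
        ≡⟨ ring₁ P Q t c′ (X j) (Y j) ⟩
      ((P * t + Q) * Q - P * (P * c′)) * (P * Φ j)
        ≡⟨ cong (λ z → ((P * t + Q) * Q - P * z) * (P * Φ j)) P*c′≡ ⟩
      ((P * t + Q) * Q - P * (t * Q + R)) * (P * Φ j)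
        ≡⟨ ring₂ P Q R t (Φ j) ⟩
      P * (- e * Φ j) ∎)
      where
      open ≡-Reasoning
      Y-periodic′ : Y (L ℕ.+ j) ≡ P * c′ * X j + Q * Y j
      Y-periodic′ = trans (Y-periodic j) (cong (λ z → z * X j + Q * Y j) (trans (cong (_+ R) (ℤP.*-comm Q t)) (sym P*c′≡)))
      ring₁ : ∀ P Q t c x y →
        P * ((P * c * x + Q * y) * (P * c * x + Q * y) + t * ((P * t + Q) * x + P * y) * (P * c * x + Q * y)
             - c * ((P * t + Q) * x + P * y) * ((P * t + Q) * x + P * y))
        ≡ ((P * t + Q) * Q - P * (P * c)) * (P * (y * y + t * x * y - c * x * x))
      ring₁ = solve-∀
      ring₂ : ∀ P Q R t z → ((P * t + Q) * Q - P * (t * Q + R)) * (P * z) ≡ P * (- (P * R - Q * Q) * z)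
      ring₂ = solve-∀

    S : ℕ
    S = ∑∣ Φ ∣ L

    ∣Φ∣≤S : ∀ j → ∣ Φ j ∣ ℕ.≤ S
    ∣Φ∣≤S = bounded-if-periodic-up-to-sign Φ L (λ j →
      trans (cong ∣_∣ (Φ-periodic j)) (∣Unit*i∣≡∣i∣ (Unit-neg e-unit) (Φ j)))

    B C : ℤ
    B = t - a₀ - a₀
    C = a₀ * a₀ - t * a₀ - c′

    F : ℤ → ℤ → ℤ
    F x y = x * x + B * x * y + C * y * y

    F-pq≡Φ : ∀ j → F (p j) (q j) ≡ Φ j
    F-pq≡Φ j rewrite p≡ j | q≡ j = ring a₀ t c′ (X j) (Y j)
      where
      ring : ∀ a₀ t c x y → (a₀ * x + y) * (a₀ * x + y) + (t - a₀ - a₀) * (a₀ * x + y) * x + (a₀ * a₀ - t * a₀ - c) * x * x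
                          ≡ y * y + t * x * y - c * x * x
      ring = solve-∀

    F-s≐ : ∀ j → s j ℚ.* s j ℚ.+ fromℤ B ℚ.* s j ℚ.+ fromℤ C ℚ.- 0ℚ ≐ Φ j ÷ q j * q j
    F-s≐ j = ≐-rescale (≐-- (≐-+ (≐-+ (≐-* (s≐ j) (s≐ j)) (≐-* (fromℤ-≐ B) (s≐ j))) (fromℤ-≐ C)) 0≐) (1≤* (1≤q j) (1≤q j))
               (trans (ring (p j) (q j) B C) (cong (λ z → z * ((q j * q j * (+ 1 * q j)) * + 1 * + 1)) (F-pq≡Φ j)))
      where
      ring : ∀ p q B C → (((p * p * (+ 1 * q) + B * p * (q * q)) * + 1 + C * (q * q * (+ 1 * q))) * + 1 - 0ℤ * ((q * q * (+ 1 * q)) * + 1)) * (q * q)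
                         ≡ (p * p + B * p * q + C * q * q) * ((q * q * (+ 1 * q)) * + 1 * + 1)
      ring = solve-∀

    limit-is-root : LimitIsRootOfMonicQuadratic s B C
    limit-is-root ε ε>0 = suc (K ℕ.+ K) , λ j N≤j → ≐-< (≐-∣∣ (F-s≐ j)) (↥÷↧ ε) (small j N≤j)
      where
      E = ℚ.↥ ε
      D = ℚ.↧ ε
      K = (S ℕ.+ 1) ℕ.* ℚ.↧ₙ ε
      1≤E = 1≤↥ {ε} ε>0
      small : ∀ j → suc (K ℕ.+ K) ℕ.≤ j → ∣ Φ j ∣ᶻ * D < E * (q j * q j)
      small j N≤j = begin-strict
        ∣ Φ j ∣ᶻ * D           ≤⟨ *-monoʳ-≤-nonneg (0≤+ _) (ℤ.+≤+ (∣Φ∣≤S j)) ⟩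
        + S * D                <⟨ <-by (D - + 1) (trans (ℤP.pos-* (S ℕ.+ 1) (ℚ.↧ₙ ε)) (ring (+ S) D))
                                           (ℤP.i≤j⇒0≤j-i (ℤ.+≤+ (ℕ.s≤s ℕ.z≤n))) ⟩
        + K                    <⟨ q-large K j N≤j ⟩
        q j                    ≤⟨ ≤-by ((q j - + 1) * q j) (ring′ (q j)) (*-nonneg (ℤP.i≤j⇒0≤j-i (1≤q j)) (1≤⇒0≤ (1≤q j))) ⟩
        q j * q j              ≤⟨ ≤-by ((E - + 1) * (q j * q j)) (ring″ E (q j * q j))
                                           (*-nonneg (ℤP.i≤j⇒0≤j-i 1≤E) (*-nonneg (1≤⇒0≤ (1≤q j)) (1≤⇒0≤ (1≤q j)))) ⟩
        E * (q j * q j)        ∎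
        where
        open ℤP.≤-Reasoning
        ring : ∀ S D → (S + + 1) * D ≡ S * D + (D - + 1) + + 1
        ring = solve-∀
        ring′ : ∀ q → q * q ≡ q + (q - + 1) * q
        ring′ = solve-∀
        ring″ : ∀ E x → E * x ≡ x + (E - + 1) * x
        ring″ = solve-∀

    -- If s → u / d, then F u d * q² = F p q * d² - m * (m + 2 u q + B q d) with m = p d - u q,
    -- and m is so small that this forces F u d = 0.
    module _ (r : ℚ) (s→r : ConvergesTo s r) where

      u d W : ℤ
      u = ℚ.↥ r
      d = ℚ.↧ r
      W = d + ∣ u ∣ᶻ + ∣ u ∣ᶻ + ∣ B ∣ᶻ * d

      1≤d : + 1 ≤ d
      1≤d = ℤ.+≤+ (ℕ.s≤s ℕ.z≤n)

      0≤d : 0ℤ ≤ d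
      0≤d = 1≤⇒0≤ 1≤d

      1≤W : + 1 ≤ W
      1≤W = ℤP.≤-trans 1≤d (≤-by (∣ u ∣ᶻ + ∣ u ∣ᶻ + ∣ B ∣ᶻ * d) (ring d ∣ u ∣ᶻ ∣ B ∣ᶻ)
                               (+-nonneg (+-nonneg (∣∣ᶻ-nonneg u) (∣∣ᶻ-nonneg u)) (*-nonneg (∣∣ᶻ-nonneg B) 0≤d)))
        where
        ring : ∀ d a b → d + a + a + b * d ≡ d + (a + a + b * d)
        ring = solve-∀

      1≤2Wd : + 1 ≤ + 2 * W * d
      1≤2Wd = 1≤* (1≤* {+ 2} (ℤ.+≤+ (ℕ.s≤s ℕ.z≤n)) 1≤W) 1≤d

      ε : ℚ
      ε = frac (+ 1) (+ 2 * W * d)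

      K : ℕ
      K = S ℕ.* (ℚ.↧ₙ r ℕ.* ℚ.↧ₙ r)

      -- beyond the threshold of s → r for ε, and large enough that 2 S d² < q j
      j : ℕ
      j = proj₁ (s→r ε (1/q-positive 1≤2Wd)) ℕ.+ suc ((K ℕ.+ K) ℕ.+ (K ℕ.+ K))

      0≤q = 1≤⇒0≤ (1≤q j)

      m : ℤ
      m = p j * d - u * q j

      ∣m∣·2Wd<q·d : ∣ m ∣ᶻ * (+ 2 * W * d) < q j * d
      ∣m∣·2Wd<q·d = subst (∣ m ∣ᶻ * (+ 2 * W * d) <_) (ℤP.*-identityˡ _)
        (≐-<⁻¹ (≐-∣∣ (≐-- (s≐ j) (↥÷↧ r))) (frac-≐ (+ 1) 1≤2Wd)
               (proj₂ (s→r ε (1/q-positive 1≤2Wd)) j (ℕP.m≤m+n _ _)))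

      2∣m∣W<q : + 2 * ∣ m ∣ᶻ * W < q j
      2∣m∣W<q = ℤP.*-cancelʳ-<-nonNeg d {{ℤ.nonNegative 0≤d}} (subst (_< q j * d) (ring ∣ m ∣ᶻ W d) ∣m∣·2Wd<q·d)
        where
        ring : ∀ m W d → m * (+ 2 * W * d) ≡ + 2 * m * W * d
        ring = solve-∀

      2Sd²<q : + 2 * (+ S * (d * d)) < q j
      2Sd²<q = subst (_< q j) (trans (ℤP.pos-+ K K) (trans (cong₂ _+_ K≡Sd² K≡Sd²) (ring _)))
                 (q-large (K ℕ.+ K) j (ℕP.m≤n+m _ _))
        where
        K≡Sd² : + K ≡ + S * (d * d)
        K≡Sd² = trans (ℤP.pos-* S _) (cong (λ x → + S * x) (ℤP.pos-* (ℚ.↧ₙ r) (ℚ.↧ₙ r)))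
        ring : ∀ x → x + x ≡ + 2 * x
        ring = solve-∀

      ∣m∣≤qd : ∣ m ∣ᶻ ≤ q j * d
      ∣m∣≤qd = begin
        ∣ m ∣ᶻ              ≤⟨ ≤-by (∣ m ∣ᶻ * (+ 2 * W - + 1)) (ring ∣ m ∣ᶻ W) (*-nonneg (∣∣ᶻ-nonneg m) 0≤2W-1) ⟩
        + 2 * ∣ m ∣ᶻ * W    ≤⟨ ℤP.<⇒≤ 2∣m∣W<q ⟩
        q j                 ≤⟨ ≤-by (q j * (d - + 1)) (ring′ (q j) d) (*-nonneg 0≤q (ℤP.i≤j⇒0≤j-i 1≤d)) ⟩
        q j * d             ∎
        where
        open ℤP.≤-Reasoning
        ring : ∀ m W → + 2 * m * W ≡ m + m * (+ 2 * W - + 1)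
        ring = solve-∀
        ring′ : ∀ q d → q * d ≡ q + q * (d - + 1)
        ring′ = solve-∀
        ring″ : ∀ W → + 2 * W ≡ W + W
        ring″ = solve-∀
        0≤2W-1 = ℤP.i≤j⇒0≤j-i (ℤP.≤-trans 1≤W (≤-by W (ring″ W) (1≤⇒0≤ 1≤W)))

      ∣m+2uq+Bqd∣≤qW : ∣ m + + 2 * u * q j + B * q j * d ∣ᶻ ≤ q j * W
      ∣m+2uq+Bqd∣≤qW = begin
        ∣ m + + 2 * u * q j + B * q j * d ∣ᶻ              ≤⟨ ∣+∣ᶻ≤ (m + + 2 * u * q j) (B * q j * d) ⟩
        ∣ m + + 2 * u * q j ∣ᶻ + ∣ B * q j * d ∣ᶻ         ≤⟨ ℤP.+-monoˡ-≤ ∣ B * q j * d ∣ᶻ (∣+∣ᶻ≤ m (+ 2 * u * q j)) ⟩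
        ∣ m ∣ᶻ + ∣ + 2 * u * q j ∣ᶻ + ∣ B * q j * d ∣ᶻ    ≡⟨ cong₂ (λ x y → ∣ m ∣ᶻ + x + y)
                                                              (trans (∣*∣ᶻ-nonneg (+ 2 * u) 0≤q) (cong (_* q j) (∣*∣ᶻ (+ 2) u)))
                                                              (trans (∣*∣ᶻ-nonneg (B * q j) 0≤d) (cong (_* d) (∣*∣ᶻ-nonneg B 0≤q))) ⟩
        ∣ m ∣ᶻ + + 2 * ∣ u ∣ᶻ * q j + ∣ B ∣ᶻ * q j * d  ≤⟨ ℤP.+-monoˡ-≤ (∣ B ∣ᶻ * q j * d)
                                                            (ℤP.+-monoˡ-≤ (+ 2 * ∣ u ∣ᶻ * q j) ∣m∣≤qd) ⟩
        q j * d + + 2 * ∣ u ∣ᶻ * q j + ∣ B ∣ᶻ * q j * d ≡⟨ ring (q j) d ∣ u ∣ᶻ ∣ B ∣ᶻ ⟩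
        q j * W                                         ∎
        where
        open ℤP.≤-Reasoning
        ring : ∀ q d u b → q * d + + 2 * u * q + b * q * d ≡ q * (d + u + u + b * d)
        ring = solve-∀

      ∣F-ud∣·q²≤ : ∣ F u d ∣ᶻ * (q j * q j) ≤ + S * (d * d) + ∣ m ∣ᶻ * (q j * W)
      ∣F-ud∣·q²≤ = begin
        ∣ F u d ∣ᶻ * (q j * q j)                             ≡⟨ ∣*∣ᶻ-nonneg (F u d) (*-nonneg 0≤q 0≤q) ⟨
        ∣ F u d * (q j * q j) ∣ᶻ                             ≡⟨ cong ∣_∣ᶻ (ring (p j) (q j) u d B C) ⟩
        ∣ F (p j) (q j) * (d * d) - m * X′ ∣ᶻ                ≤⟨ ∣-∣ᶻ≤ (F (p j) (q j) * (d * d)) (m * X′) ⟩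
        ∣ F (p j) (q j) * (d * d) ∣ᶻ + ∣ m * X′ ∣ᶻ           ≡⟨ cong₂ _+_ (∣*∣ᶻ-nonneg (F (p j) (q j)) (*-nonneg 0≤d 0≤d))
                                                                       (∣*∣ᶻ m X′) ⟩
        ∣ F (p j) (q j) ∣ᶻ * (d * d) + ∣ m ∣ᶻ * ∣ X′ ∣ᶻ      ≤⟨ ℤP.+-mono-≤ (*-monoʳ-≤-nonneg (*-nonneg 0≤d 0≤d) ∣F-pq∣≤S)
                                                                           (*-monoˡ-≤-nonneg (∣∣ᶻ-nonneg m) ∣m+2uq+Bqd∣≤qW) ⟩
        + S * (d * d) + ∣ m ∣ᶻ * (q j * W)                   ∎
        where
        open ℤP.≤-Reasoning
        X′ = m + + 2 * u * q j + B * q j * d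
        ∣F-pq∣≤S : ∣ F (p j) (q j) ∣ᶻ ≤ + S
        ∣F-pq∣≤S = subst (λ x → ∣ x ∣ᶻ ≤ + S) (sym (F-pq≡Φ j)) (ℤ.+≤+ (∣Φ∣≤S j))
        ring : ∀ p q u d B C → (u * u + B * u * d + C * d * d) * (q * q)
               ≡ (p * p + B * p * q + C * q * q) * (d * d) - (p * d - u * q) * ((p * d - u * q) + + 2 * u * q + B * q * d)
        ring = solve-∀

      rational-limit-is-root : F u d ≡ 0ℤ
      rational-limit-is-root = ℤP.∣i∣≡0⇒i≡0 (ℤP.+-injective (nonneg-multiple-< (∣∣ᶻ-nonneg (F u d)) (*-nonneg 0≤q 0≤q)
        (ℤP.≤-<-trans ∣F-ud∣·q²≤ (sum-<-square (*-nonneg (0≤+ S) (*-nonneg 0≤d 0≤d)) (∣∣ᶻ-nonneg m) (1≤⇒0≤ 1≤W) 2Sd²<q 2∣m∣W<q))))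

    no-integer-root : 1 ℕ.≤ n → ∀ u → F u (+ 1) ≢ 0ℤ
    no-integer-root 1≤n u root = square≢square+4·unit (P * (+ 2 * u + B)) (P * t + + 2 * Q) e-unit 3≤Pt+2Q (begin
      P * (+ 2 * u + B) * (P * (+ 2 * u + B))                      ≡⟨ ring₁ P u a₀ t c′ ⟩
      P * P * + 4 * F u (+ 1) + P * P * t * t + + 4 * P * (P * c′) ≡⟨ cong₂ (λ x y → P * P * + 4 * x + P * P * t * t + + 4 * P * y) root P*c′≡ ⟩
      P * P * + 4 * 0ℤ + P * P * t * t + + 4 * P * (t * Q + R)    ≡⟨ ring₂ P t Q R ⟩
      (P * t + + 2 * Q) * (P * t + + 2 * Q) + + 4 * e              ∎)
      where
      open ≡-Reasoning
      3≤Pt+2Q = ≤-by (P * t - + 1 + + 2 * (Q - + 1)) (ring P t Q)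
                  (+-nonneg (ℤP.i≤j⇒0≤j-i (1≤* P≥1 1≤t)) (*-nonneg (0≤+ 2) (ℤP.i≤j⇒0≤j-i (Q≥1 1≤n))))
        where
        ring : ∀ P t Q → P * t + + 2 * Q ≡ + 3 + (P * t - + 1 + + 2 * (Q - + 1))
        ring = solve-∀
      -- the discriminant of X² + B X + C is t² + 4c′
      ring₁ : ∀ P u a₀ t c → P * (+ 2 * u + (t - a₀ - a₀)) * (P * (+ 2 * u + (t - a₀ - a₀)))
              ≡ P * P * + 4 * (u * u + (t - a₀ - a₀) * u * + 1 + (a₀ * a₀ - t * a₀ - c) * + 1 * + 1) + P * P * t * t + + 4 * P * (P * c)
      ring₁ = solve-∀
      ring₂ : ∀ P t Q R → P * P * + 4 * 0ℤ + P * P * t * t + + 4 * P * (t * Q + R) ≡ (P * t + + 2 * Q) * (P * t + + 2 * Q) + + 4 * (P * R - Q * Q)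
      ring₂ = solve-∀

    irrational : 1 ℕ.≤ n → IrrationalLimit s
    irrational 1≤n r s→r = no-integer-root 1≤n (ℚ.↥ r)
      (subst (λ d → F (ℚ.↥ r) d ≡ 0ℤ) (cong +_ (rational-root-of-monic-quadratic-is-integral B C r root)) root)
      where
      root = rational-limit-is-root r s→r

  module Distinct (a₀ t t′ : ℤ) (1≤t : + 1 ≤ t) (1≤t′ : + 1 ≤ t′) (t′+2≤t : t′ + + 2 ≤ t) where
    module C  = Convergents a₀ t 1≤t
    module C′ = Convergents a₀ t′ 1≤t′
    open C using (0≤X; 0≤Y; Y≤X; q-after-period≤)
    open C′ using () renaming (0≤X to 0≤X′; 0≤Y to 0≤Y′; Y≤X to Y′≤X′; q-after-period≤ to q′-after-period≤)

    p-cross-q : ∀ j → C.p j * C′.q j - C′.p j * C.q j ≡ C.Y j * C′.X j - C′.Y j * C.X j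
    p-cross-q j rewrite C.p≡ j | C.q≡ j | C′.p≡ j | C′.q≡ j = ring a₀ (C.X j) (C.Y j) (C′.X j) (C′.Y j)
      where
      ring : ∀ a₀ x y x′ y′ → (a₀ * x + y) * x′ - (a₀ * x′ + y′) * x ≡ y * x′ - y′ * x
      ring = solve-∀

    module _ (i : ℕ) where

      x y x′ y′ : ℤ
      x  = C.X i
      y  = C.Y i
      x′ = C′.X i
      y′ = C′.Y i

      Δ : ℤ
      Δ = (t * x + y) * x′ - (t′ * x′ + y′) * x

      p-cross-q-after-period : let j = L ℕ.+ i in C.p j * C′.q j - C′.p j * C.q j ≡ - e * Δ
      p-cross-q-after-period = begin
        C.p j * C′.q j - C′.p j * C.q j   ≡⟨ p-cross-q j ⟩
        C.Y j * C′.X j - C′.Y j * C.X j   ≡⟨ cong₂ (λ u v → u - v) (cong₂ _*_ (C.Y-periodic i) (C′.X-periodic i))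
                                                                    (cong₂ _*_ (C′.Y-periodic i) (C.X-periodic i)) ⟩
        ((Q * t + R) * x + Q * y) * ((P * t′ + Q) * x′ + P * y′) - ((Q * t′ + R) * x′ + Q * y′) * ((P * t + Q) * x + P * y)
                                          ≡⟨ ring P Q R t t′ x y x′ y′ ⟩
        - e * Δ                           ∎
        where
        open ≡-Reasoning
        j = L ℕ.+ i
        ring : ∀ P Q R t t′ x y x′ y′ →
          ((Q * t + R) * x + Q * y) * ((P * t′ + Q) * x′ + P * y′) - ((Q * t′ + R) * x′ + Q * y′) * ((P * t + Q) * x + P * y)
          ≡ - (P * R - Q * Q) * ((t * x + y) * x′ - (t′ * x′ + y′) * x)
        ring = solve-∀

      xx′≤Δ : x * x′ ≤ Δ
      xx′≤Δ = ≤-by ((t - (t′ + + 2)) * x * x′ + y * x′ + (x′ - y′) * x) (ring t t′ x y x′ y′)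
        (+-nonneg (+-nonneg (*-nonneg (*-nonneg (ℤP.i≤j⇒0≤j-i t′+2≤t) (0≤X i)) (0≤X′ i)) (*-nonneg (0≤Y i) (0≤X′ i)))
                  (*-nonneg (ℤP.i≤j⇒0≤j-i (Y′≤X′ i)) (0≤X i)))
        where
        ring : ∀ t t′ x y x′ y′ → (t * x + y) * x′ - (t′ * x′ + y′) * x
                                 ≡ x * x′ + ((t - (t′ + + 2)) * x * x′ + y * x′ + (x′ - y′) * x)
        ring = solve-∀

    E : ℤ
    E = (P * (t + + 1) + Q) * (P * (t′ + + 1) + Q)

    1≤E : + 1 ≤ E
    1≤E = 1≤* (1≤P[t+1]+Q 1≤t) (1≤P[t+1]+Q 1≤t′)

    δ : ℚ
    δ = frac (+ 1) E

    δ≤∣s-s′∣-after-period : ∀ i → δ ℚ.≤ ℚ.∣ C.s (L ℕ.+ i) ℚ.- C′.s (L ℕ.+ i) ∣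
    δ≤∣s-s′∣-after-period i = ≐-≤ (frac-≐ (+ 1) 1≤E) (≐-∣∣ (≐-- (C.s≐ j) (C′.s≐ j))) (begin
      + 1 * (C.q j * C′.q j)                    ≡⟨ ℤP.*-identityˡ _ ⟩
      C.q j * C′.q j                            ≤⟨ ℤP.≤-trans (*-monoʳ-≤-nonneg (1≤⇒0≤ (C′.1≤q j)) (q-after-period≤ i))
                                                     (*-monoˡ-≤-nonneg (*-nonneg (1≤⇒0≤ (1≤P[t+1]+Q 1≤t)) (0≤X i)) (q′-after-period≤ i)) ⟩
      (K * x i) * (K′ * x′ i)                   ≡⟨ ring K K′ (x i) (x′ i) ⟩
      x i * x′ i * E                               ≤⟨ *-monoʳ-≤-nonneg (1≤⇒0≤ 1≤E) (xx′≤Δ i) ⟩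
      Δ i * E                                   ≡⟨ cong (_* E) (sym (ℤP.0≤i⇒+∣i∣≡i 0≤Δ)) ⟩
      ∣ Δ i ∣ᶻ * E                              ≡⟨ cong (λ z → + z * E) (sym (trans (cong ∣_∣ (p-cross-q-after-period i))
                                                                                (∣Unit*i∣≡∣i∣ (Unit-neg e-unit) (Δ i)))) ⟩
      ∣ C.p j * C′.q j - C′.p j * C.q j ∣ᶻ * E  ∎)
      where
      open ℤP.≤-Reasoning
      j = L ℕ.+ i
      K = P * (t + + 1) + Q
      K′ = P * (t′ + + 1) + Q
      0≤Δ = ℤP.≤-trans (*-nonneg (0≤X i) (0≤X′ i)) (xx′≤Δ i)
      ring : ∀ K K′ x x′ → (K * x) * (K′ * x′) ≡ x * x′ * (K * K′)
      ring = solve-∀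

    distinct : LimitsDistinct C.s C′.s
    distinct = δ , 1/q-positive 1≤E , L , λ j L≤j →
      subst (λ k → δ ℚ.≤ ℚ.∣ C.s k ℚ.- C′.s k ∣) (ℕP.m+[n∸m]≡n L≤j) (δ≤∣s-s′∣-after-period (j ℕ.∸ L))

  module UnitInterval (t : ℤ) (1≤t : + 1 ≤ t) where
    open Convergents (+ 0) t 1≤t

    c₀ c₁ : ℤ
    c₀ = block t 0
    c₁ = block t 1

    p≡Y : ∀ j → p j ≡ Y j
    p≡Y j = trans (p≡ j) (ring (X j) (Y j))
      where
      ring : ∀ x y → + 0 * x + y ≡ y
      ring = solve-∀

    X≤[c₀+1]Y : ∀ {j} → 2 ℕ.≤ j → 0ℤ ≤ - + 1 * X j + (c₀ + + 1) * Y j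
    X≤[c₀+1]Y 2≤j = proj₁ (∏A-NonnegForm c≥1 (- + 1) (c₀ + + 1) 2≤j base)
      where
      ring₁ : ∀ c₀ c₁ → - + 1 * (c₀ * c₁ + + 1) + (c₀ + + 1) * c₁ ≡ c₁ - + 1
      ring₁ = solve-∀
      ring₂ : ∀ c₀ → - + 1 * c₀ + (c₀ + + 1) * + 1 ≡ + 1
      ring₂ = solve-∀
      base : NonnegForm (- + 1) (c₀ + + 1) (∏A 2 (block t))
      base = subst (NonnegForm (- + 1) (c₀ + + 1)) (sym (∏A-2 (block t)))
        (subst (0ℤ ≤_) (sym (ring₁ c₀ c₁)) (ℤP.i≤j⇒0≤j-i (c≥1 1)) , subst (0ℤ ≤_) (sym (ring₂ c₀)) (0≤+ 1))

    [[c₁+1]c₀+1]Y≤[c₁+1]X : ∀ {j} → 3 ℕ.≤ j → 0ℤ ≤ (c₁ + + 1) * X j + - ((c₁ + + 1) * c₀ + + 1) * Y j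
    [[c₁+1]c₀+1]Y≤[c₁+1]X 3≤j = proj₁ (∏A-NonnegForm c≥1 (c₁ + + 1) (- ((c₁ + + 1) * c₀ + + 1)) 3≤j base)
      where
      ring₁ : ∀ c₀ c₁ c₂ → (c₁ + + 1) * ((c₀ * c₁ + + 1) * c₂ + c₀) + - ((c₁ + + 1) * c₀ + + 1) * (c₁ * c₂ + + 1) ≡ c₂ - + 1
      ring₁ = solve-∀
      ring₂ : ∀ c₀ c₁ → (c₁ + + 1) * (c₀ * c₁ + + 1) + - ((c₁ + + 1) * c₀ + + 1) * c₁ ≡ + 1
      ring₂ = solve-∀
      base : NonnegForm (c₁ + + 1) (- ((c₁ + + 1) * c₀ + + 1)) (∏A 3 (block t))
      base = subst (NonnegForm (c₁ + + 1) (- ((c₁ + + 1) * c₀ + + 1))) (sym (∏A-3 (block t)))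
        (subst (0ℤ ≤_) (sym (ring₁ c₀ c₁ (block t 2))) (ℤP.i≤j⇒0≤j-i (c≥1 2)) , subst (0ℤ ≤_) (sym (ring₂ c₀ c₁)) (0≤+ 1))

    D : ℤ
    D = (c₀ + + 1) * (c₁ + + 2)

    1≤D : + 1 ≤ D
    1≤D = 1≤* (≤-by c₀ (ℤP.+-comm c₀ (+ 1)) (1≤⇒0≤ (c≥1 0)))
               (≤-by (c₁ + + 1) (ring c₁) (+-nonneg (1≤⇒0≤ (c≥1 1)) (0≤+ 1)))
      where
      ring : ∀ c₁ → c₁ + + 2 ≡ + 1 + (c₁ + + 1)
      ring = solve-∀

    δ : ℚ
    δ = frac (+ 1) D

    module _ {j : ℕ} (3≤j : 3 ℕ.≤ j) where

      0≤[c₀+1] = +-nonneg (1≤⇒0≤ (c≥1 0)) (0≤+ 1)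
      0≤[c₁+1] = +-nonneg (1≤⇒0≤ (c≥1 1)) (0≤+ 1)

      δ≤s : δ ℚ.≤ s j
      δ≤s = ≐-≤ (frac-≐ (+ 1) 1≤D) (s≐ j) (subst₂ (λ u v → + 1 * v ≤ u * D) (sym (p≡Y j)) (sym (q≡ j))
        (≤-by (- + 1 * X j + (c₀ + + 1) * Y j + Y j * (c₀ + + 1) * (c₁ + + 1)) (ring (X j) (Y j) c₀ c₁)
              (+-nonneg (X≤[c₀+1]Y (ℕP.≤-trans (ℕP.n≤1+n 2) 3≤j)) (*-nonneg (*-nonneg (0≤Y j) 0≤[c₀+1]) 0≤[c₁+1]))))
        where
        ring : ∀ x y c₀ c₁ → y * ((c₀ + + 1) * (c₁ + + 2)) ≡ + 1 * x + (- + 1 * x + (c₀ + + 1) * y + y * (c₀ + + 1) * (c₁ + + 1))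
        ring = solve-∀

      s≤1-δ : s j ℚ.≤ 1ℚ ℚ.- δ
      s≤1-δ = ≐-≤ (s≐ j) (≐-- 1≐ (frac-≐ (+ 1) 1≤D)) (subst₂ (λ u v → u * (+ 1 * D) ≤ (+ 1 * D - + 1 * + 1) * v) (sym (p≡Y j)) (sym (q≡ j))
        (≤-by ((c₀ + + 1) * ((c₁ + + 1) * X j + - ((c₁ + + 1) * c₀ + + 1) * Y j) + c₀ * X j + (c₀ + + 1) * (c₁ + + 1) * (c₀ - + 1) * Y j)
              (ring (X j) (Y j) c₀ c₁)
              (+-nonneg (+-nonneg (*-nonneg 0≤[c₀+1] ([[c₁+1]c₀+1]Y≤[c₁+1]X 3≤j)) (*-nonneg (1≤⇒0≤ (c≥1 0)) (0≤X j)))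
                        (*-nonneg (*-nonneg (*-nonneg 0≤[c₀+1] 0≤[c₁+1]) (ℤP.i≤j⇒0≤j-i (c≥1 0))) (0≤Y j)))))
        where
        ring : ∀ x y c₀ c₁ → (+ 1 * ((c₀ + + 1) * (c₁ + + 2)) - + 1 * + 1) * x
               ≡ y * (+ 1 * ((c₀ + + 1) * (c₁ + + 2)))
                 + ((c₀ + + 1) * ((c₁ + + 1) * x + - ((c₁ + + 1) * c₀ + + 1) * y) + c₀ * x + (c₀ + + 1) * (c₁ + + 1) * (c₀ - + 1) * y)
        ring = solve-∀

    in-unit-interval : LimitInOpenUnitInterval s
    in-unit-interval = δ , 1/q-positive 1≤D , 3 , λ j 3≤j → δ≤s 3≤j , s≤1-δ 3≤j

  w : ℤ
  w = e * R * Q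

  k₁ : ℤ
  k₁ = ∣ w ∣ᶻ + + 1

  0≤k₁ : 0ℤ ≤ k₁
  0≤k₁ = 0≤+ (∣ w ∣ ℕ.+ 1)

  c′ : ℤ → ℤ
  c′ k = e * R * R + k * Q

  P*c′≡tQ+R : ∀ k → P * c′ k ≡ (w + P * k) * Q + R
  P*c′≡tQ+R k = sym (begin
    (w + P * k) * Q + R                ≡⟨ ring P Q R k ⟩
    P * c′ k + R * (+ 1 - e * e)       ≡⟨ cong (λ z → P * c′ k + R * (+ 1 - z)) (Unit-square e-unit) ⟩
    P * c′ k + R * (+ 1 - + 1)         ≡⟨ ring′ (P * c′ k) R ⟩
    P * c′ k                           ∎)
    where
    open ≡-Reasoning
    ring : ∀ P Q R k → ((P * R - Q * Q) * R * Q + P * k) * Q + R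
                       ≡ P * ((P * R - Q * Q) * R * R + k * Q) + R * (+ 1 - (P * R - Q * Q) * (P * R - Q * Q))
    ring = solve-∀
    ring′ : ∀ x R → x + R * (+ 1 - + 1) ≡ x
    ring′ = solve-∀

  1≤w+Pk : ∀ {k} → k₁ ≤ k → + 1 ≤ w + P * k
  1≤w+Pk {k} k₁≤k = ≤-by ((w + ∣ w ∣ᶻ) + (P - + 1) * k + (k - k₁)) (ring w ∣ w ∣ᶻ P k)
    (+-nonneg (+-nonneg (0≤i+∣i∣ᶻ w) (*-nonneg (ℤP.i≤j⇒0≤j-i P≥1) (ℤP.≤-trans 0≤k₁ k₁≤k))) (ℤP.i≤j⇒0≤j-i k₁≤k))
    where
    ring : ∀ w a P k → w + P * k ≡ + 1 + ((w + a) + (P - + 1) * k + (k - (a + + 1)))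
    ring = solve-∀

  w+Pk-gap : ∀ {k k′} → k′ + + 2 ≤ k → w + P * k′ + + 2 ≤ w + P * k
  w+Pk-gap {k} {k′} k′+2≤k = ≤-by ((P - + 1) * (k - (k′ + + 2) + + 2) + (k - (k′ + + 2))) (ring w P k k′)
    (+-nonneg (*-nonneg (ℤP.i≤j⇒0≤j-i P≥1) (+-nonneg (ℤP.i≤j⇒0≤j-i k′+2≤k) (0≤+ 2))) (ℤP.i≤j⇒0≤j-i k′+2≤k))
    where
    ring : ∀ w P k k′ → w + P * k ≡ w + P * k′ + + 2 + ((P - + 1) * (k - (k′ + + 2) + + 2) + (k - (k′ + + 2)))
    ring = solve-∀

corollary2p3 : (n : ℕ) → 1 Data.Nat.≤ n → (a : Fin n → ℤ)
    → (∀ i → + 1 ≤ a i)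
    → (∀ i → a i ≡ a (opposite i))
    → Σ ℤ λ k₁ → Σ ℤ λ w → Σ ℤ λ z →
      ((a₀ k : ℤ) → k₁ ≤ k →
          (+ 1 ≤ w + z * k)
        × LimitIsAlgebraicIntegerOfDegree2 (αseq a₀ a (w + z * k))
        × LimitIsAlgebraicIntegerOfDegree2 (αseq (+ 0) a (w + z * k))
        × LimitInOpenUnitInterval (αseq (+ 0) a (w + z * k)))
      × ((a₀ : ℤ) (ks : List ℤ) → Σ ℤ λ k → k₁ ≤ k
          × All (λ k′ → k₁ ≤ k′ →
                   LimitsDistinct (αseq a₀ a (w + z * k)) (αseq a₀ a (w + z * k′))) ks)
corollary2p3 n 1≤n a a≥1 pal =
  k₁ , w , P ,
  (λ a₀ k k₁≤k → 1≤w+Pk k₁≤k , algebraic a₀ k₁≤k , algebraic (+ 0) k₁≤k ,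
                 UnitInterval.in-unit-interval (w + P * k) (1≤w+Pk k₁≤k)) ,
  fresh
  where
  open PeriodicCF a a≥1 pal

  algebraic : ∀ a₀ {k} → k₁ ≤ k → LimitIsAlgebraicIntegerOfDegree2 (αseq a₀ a (w + P * k))
  algebraic a₀ {k} k₁≤k = (B , C , limit-is-root) , irrational 1≤n
    where
    open Quadratic a₀ (w + P * k) (c′ k) (1≤w+Pk k₁≤k) (P*c′≡tQ+R k)

  fresh : (a₀ : ℤ) (ks : List ℤ) → Σ ℤ λ k → k₁ ≤ k
          × All (λ k′ → k₁ ≤ k′ → LimitsDistinct (αseq a₀ a (w + P * k)) (αseq a₀ a (w + P * k′))) ks
  fresh a₀ ks = k , k₁≤k ,
    All.map (λ {k′} k′≤N k₁≤k′ → Distinct.distinct a₀ (w + P * k) (w + P * k′) (1≤w+Pk k₁≤k) (1≤w+Pk k₁≤k′)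
                                   (w+Pk-gap (ℤP.+-monoˡ-≤ (+ 2) (ℤP.≤-trans k′≤N N≤k₁+N))))
            (≤list-bound ks)
    where
    N = list-bound ks
    k = k₁ + N + + 2
    N≤k₁+N = ≤-by k₁ (ℤP.+-comm k₁ N) 0≤k₁
    k₁≤k = ≤-by (N + + 2) (ℤP.+-assoc k₁ N (+ 2)) (+-nonneg (0≤list-bound ks) (0≤+ 2))
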